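{- Let $\phi$ be a linear $r$-CNF formula and let $k\ge r$. Suppose that $\phi$ has no $\mathrm{Res}(\oplus)$ refutation of width at most $k$. Then there is a $k$-winning strategy for $\phi$.
   Context: A linear clause is a disjunction of linear literals $f=\alpha$ ($f$ a linear form over $\mathbb{F}_2$, $\alpha\in\{0,1\}$); its width is the number of its linear literals. A linear $r$-CNF is a conjunction of linear clauses each of width at most $r$. $\mathrm{Res}(\oplus)$ rules: from $A\lor(f=0)$ and $B\lor(f=1)$ derive $A\lor B$; from $C$ derive any linear clause semantically implied by $C$. A refutation is a derivation of the empty clause from the clauses of $\phi$; its width is the maximum width of its clauses. For linear systems, $|\mathcal{F}|$ is the number of equations and $\mathcal{F}\vDash\mathcal{G}$ means every solution of $\mathcal{F}$ is a solution of $\mathcal{G}$. A non-empty family $\mathcal{H}$ of linear systems over $\mathbb{F}_2$ in the variables of $\phi$ is a $k$-winning strategy if: (1) every $\mathcal{F}\in\mathcal{H}$ has $|\mathcal{F}|\le k$; (2) for every $\mathcal{F}\in\mathcal{H}$ and every clause $C$ of $\phi$ some solution of $\mathcal{F}$ satisfies $C$; (3) if $\mathcal{G}$ is a linear system with $|\mathcal{G}|\le k$ and $\mathcal{F}\vDash\mathcal{G}$ for some $\mathcal{F}\in\mathcal{H}$, then $\mathcal{G}\in\mathcal{H}$; (4) for every $\mathcal{F}\in\mathcal{H}$ with $|\mathcal{F}|<k$ and every linear form $f$ there is $a\in\mathbb{F}_2$ with $\mathcal{F}\land(f=a)\in\mathcal{H}$. -}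

module Defs where

open import Data.Nat using (ℕ; zero; suc; _≤_)
open import Data.Bool using (Bool; true; false; _∧_; _xor_)
open import Data.Vec using (Vec; []; _∷_)
open import Data.List using (List; []; _∷_; _++_; length)
open import Data.List.Relation.Unary.All using (All)
open import Data.List.Relation.Unary.Any using (Any)
open import Data.List.Membership.Propositional using (_∈_)
open import Data.Product using (Σ; ∃; _×_; _,_)
open import Relation.Binary.PropositionalEquality using (_≡_)
open import Function.Bundles using (_⇔_)

-- Linear forms over F₂ in n variables: coefficient vectors (no constant term).
LinForm : ℕ → Set
LinForm n = Vec Bool n

Assignment : ℕ → Set
Assignment n = Vec Bool n

eval : ∀ {n} → LinForm n → Assignment n → Bool
eval []      []      = false
eval (b ∷ f) (c ∷ x) = (b ∧ c) xor eval f x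

record LinLit (n : ℕ) : Set where
  constructor _==_
  field
    form : LinForm n
    rhs  : Bool
open LinLit public

LinEq : ℕ → Set
LinEq = LinLit

SatLit : ∀ {n} → Assignment n → LinLit n → Set
SatLit x (f == α) = eval f x ≡ α

Clause : ℕ → Set
Clause n = List (LinLit n)

width : ∀ {n} → Clause n → ℕ
width = length

SatClause : ∀ {n} → Assignment n → Clause n → Set
SatClause x C = Any (SatLit x) C

CNF : ℕ → Set
CNF n = List (Clause n)

IsLinearCNF : ∀ {n} → ℕ → CNF n → Set
IsLinearCNF r φ = All (λ C → width C ≤ r) φ

_≈ₗ_ : ∀ {n} → Clause n → Clause n → Set
C ≈ₗ D = ∀ l → (l ∈ C) ⇔ (l ∈ D)

data Deriv {n : ℕ} (φ : CNF n) (k : ℕ) : Clause n → Set where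
  axiom   : ∀ {C} → C ∈ φ → width C ≤ k → Deriv φ k C
  resolve : ∀ {C₁ C₂ C} (f : LinForm n) (A B : Clause n) →
            Deriv φ k C₁ → Deriv φ k C₂ →
            C₁ ≈ₗ ((f == false) ∷ A) → C₂ ≈ₗ ((f == true) ∷ B) →
            C ≈ₗ (A ++ B) → width C ≤ k → Deriv φ k C
  weaken  : ∀ {C D} → Deriv φ k C →
            (∀ (x : Assignment n) → SatClause x C → SatClause x D) →
            width D ≤ k → Deriv φ k D

HasRefutationOfWidth : ∀ {n} → CNF n → ℕ → Set
HasRefutationOfWidth φ k = Deriv φ k []

LinSystem : ℕ → Set
LinSystem n = List (LinEq n)

Solves : ∀ {n} → Assignment n → LinSystem n → Set
Solves x F = All (SatLit x) F

_⊨_ : ∀ {n} → LinSystem n → LinSystem n → Set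
F ⊨ G = ∀ x → Solves x F → Solves x G

record IsWinningStrategy {n : ℕ} (φ : CNF n) (k : ℕ) (H : LinSystem n → Set) : Set where
  field
    nonEmpty : ∃ λ F → H F
    size     : ∀ F → H F → length F ≤ k
    satCl    : ∀ F → H F → ∀ C → C ∈ φ → ∃ λ x → Solves x F × SatClause x C
    closed   : ∀ F G → H F → length G ≤ k → F ⊨ G → H G
    extend   : ∀ F → H F → suc (length F) ≤ k → ∀ (f : LinForm n) →
               ∃ λ (a : Bool) → H ((f == a) ∷ F)

{-# OPTIONS --safe #-}
module Submission where

-- Call a system F of at most k equations refutable when its negation ¬F, a clause of width |F|,
-- is derivable in width k. Refutability is generated by three rules mirroring Res(⊕): F
-- contradicts an axiom (weakening of that axiom), F ∧ (f = 0) and F ∧ (f = 1) are both refutable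
-- (resolution on f), or F entails a refutable system (weakening). Iterated on the finitely many
-- systems of size ≤ k these rules reach a fixed point, and the systems of size ≤ k outside it form
-- a k-winning strategy: each of conditions (2)-(4) is the failure of one rule to fire, and the
-- empty system survives because ¬∅ is the empty clause. Computing the fixed point, instead of
-- taking the systems whose negation is not derivable, makes survival decidable; this is what
-- lets the strategy choose the value a in condition (4) constructively.

open import Defs
open import Level using (Level)
open import Data.Nat using (ℕ; zero; suc; _≤_; _<_; _≤?_; z≤n; s≤s)
open import Data.Nat.Properties using (≤-<-trans; m<n⇒m<1+n; m≤n⇒m≤1+n; ≤-trans; 1+n≰n)
open import Data.Bool using (Bool; true; false; not)
import Data.Bool.Properties as Bool
open import Data.Bool.Properties using (not-¬; ¬-not)
open import Data.Vec using (Vec; []; _∷_)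
open import Data.List using (List; []; _∷_; [_]; length; map; filter; cartesianProductWith)
open import Data.List.Properties using (length-map; length-filter)
open import Data.List.Relation.Unary.All as All using (All; all?)
open import Data.List.Relation.Unary.Any as Any using (Any; here; there; any?)
open import Data.List.Relation.Unary.Any.Properties using () renaming (map⁺ to Any-map⁺; map⁻ to Any-map⁻)
open import Data.List.Relation.Unary.All.Properties using (¬Any⇒All¬; ¬All⇒Any¬; Any¬⇒¬All)
open import Data.List.Membership.Propositional using (_∈_; find; lose)
open import Data.List.Membership.Propositional.Properties using (∈-cartesianProductWith⁺)
open import Data.List.Relation.Binary.BagAndSetEquality using (++-idempotent)
open import Data.Product using (∃; _×_; _,_; proj₁; proj₂)
open import Data.Sum using (_⊎_; inj₁; inj₂)
open import Function using (flip; _∘_)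
open import Function.Properties.Equivalence using () renaming (refl to ⇔-refl; sym to ⇔-sym)
open import Relation.Nullary using (¬_; Dec; yes; no; contradiction)
open import Relation.Nullary.Decidable using (map′; _×-dec_; _⊎-dec_; _→-dec_; ¬?; decidable-stable)
open import Relation.Unary using (Pred; Decidable; _⊆_)
open import Relation.Binary.PropositionalEquality using (_≡_; refl; sym; subst)

private
  variable
    a p q : Level
    A : Set a

Enumerates : List A → Set _
Enumerates {A = A} xs = (x : A) → x ∈ xs

∃?-within : {P : Pred A p} (xs : List A) → P ⊆ (_∈ xs) → Decidable P → Dec (∃ P)
∃?-within xs P⊆xs P? = map′ witness (λ (x , px) → lose (P⊆xs px) px) (any? P? xs)
  where
  witness : Any _ xs → ∃ _
  witness a = let x , _ , px = find a in x , px

∃?-over : {P : Pred A p} {xs : List A} → Enumerates xs → Decidable P → Dec (∃ P)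
∃?-over {xs = xs} enum = ∃?-within xs (λ _ → enum _)

∀?-over : {P : Pred A p} {xs : List A} → Enumerates xs → Decidable P → Dec (∀ x → P x)
∀?-over {xs = xs} enum P? =
  map′ (λ all x → All.lookup all (enum x)) (λ ∀P → All.tabulate (λ {x} _ → ∀P x)) (all? P? xs)

vectors : List A → (n : ℕ) → List (Vec A n)
vectors xs zero    = [ [] ]
vectors xs (suc n) = cartesianProductWith _∷_ xs (vectors xs n)

∈-vectors : {xs : List A} → Enumerates xs → ∀ n → Enumerates (vectors xs n)
∈-vectors enum zero    []      = here refl
∈-vectors enum (suc n) (x ∷ v) =
  ∈-cartesianProductWith⁺ _∷_ (enum x) (∈-vectors enum n v)

lists≤ : List A → ℕ → List (List A)
lists≤ xs zero    = [ [] ]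
lists≤ xs (suc k) = [] ∷ cartesianProductWith _∷_ xs (lists≤ xs k)

∈-lists≤ : {xs : List A} → Enumerates xs → ∀ {k ys} → length ys ≤ k → ys ∈ lists≤ xs k
∈-lists≤ enum {zero}  {[]}     _         = here refl
∈-lists≤ enum {suc k} {[]}     _         = here refl
∈-lists≤ enum {suc k} {y ∷ ys} (s≤s |ys|≤k) =
  there (∈-cartesianProductWith⁺ _∷_ (enum y) (∈-lists≤ enum |ys|≤k))

bools : List Bool
bools = true ∷ false ∷ []

∈-bools : Enumerates bools
∈-bools true  = here refl
∈-bools false = there (here refl)

module _ {P : Pred A p} {Q : Pred A q} (P? : Decidable P) (Q? : Decidable Q) (P⊆Q : P ⊆ Q) where

  length-filter-mono-≤ : ∀ xs → length (filter P? xs) ≤ length (filter Q? xs)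
  length-filter-mono-≤ []       = z≤n
  length-filter-mono-≤ (x ∷ xs) with ih ← length-filter-mono-≤ xs | P? x | Q? x
  ... | yes px | no ¬qx = contradiction (P⊆Q px) ¬qx
  ... | yes _  | yes _  = s≤s ih
  ... | no _   | yes _  = m≤n⇒m≤1+n ih
  ... | no _   | no _   = ih

  length-filter-mono-< : ∀ xs → Any (λ x → Q x × ¬ P x) xs →
                         length (filter P? xs) < length (filter Q? xs)
  length-filter-mono-< (x ∷ xs) (here (qx , ¬px)) with P? x | Q? x
  ... | yes px | _      = contradiction px ¬px
  ... | no _   | no ¬qx = contradiction qx ¬qx
  ... | no _   | yes _  = s≤s (length-filter-mono-≤ xs)
  length-filter-mono-< (x ∷ xs) (there any) with ih ← length-filter-mono-< xs any | P? x | Q? x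
  ... | yes px | no ¬qx = contradiction (P⊆Q px) ¬qx
  ... | yes _  | yes _  = s≤s ih
  ... | no _   | yes _  = m<n⇒m<1+n ih
  ... | no _   | no _   = ih

module _ {P : ℕ → Pred A p} (P? : ∀ m → Decidable (P m)) (increasing : ∀ m → P m ⊆ P (suc m))
         (xs : List A) where

  private
    StableAt : ℕ → Set _
    StableAt m = All (λ x → P (suc m) x → P m x) xs

    size : ℕ → ℕ
    size m = length (filter (P? m) xs)

    stable-or-grows : ∀ m → StableAt m ⊎ size m < size (suc m)
    stable-or-grows m with any? (λ x → P? (suc m) x ×-dec ¬? (P? m x)) xs
    ... | yes new        = inj₂ (length-filter-mono-< (P? m) (P? (suc m)) (increasing m) xs new)
    ... | no nothing-new = inj₁ (All.map (λ {x} old q → decidable-stable (P? m x) (λ ¬p → old (q , ¬p)))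
                                          (¬Any⇒All¬ xs nothing-new))

    stable-or-large : ∀ m → (∃ StableAt) ⊎ m ≤ size m
    stable-or-large zero = inj₂ z≤n
    stable-or-large (suc m) with stable-or-large m | stable-or-grows m
    ... | inj₁ stable | _            = inj₁ stable
    ... | inj₂ _      | inj₁ stable  = inj₁ (m , stable)
    ... | inj₂ m≤size | inj₂ growing = inj₂ (≤-<-trans m≤size growing)

  increasing-chain-stabilises : ∃ λ m → All (λ x → P (suc m) x → P m x) xs
  increasing-chain-stabilises with stable-or-large (suc (length xs))
  ... | inj₁ stable = stable
  ... | inj₂ large  = contradiction (≤-trans large (length-filter (P? _) xs)) 1+n≰n

complement : ∀ {n} → LinLit n → LinLit n
complement (f == α) = f == not α

negation : ∀ {n} → LinSystem n → Clause n
negation = map complement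

width-negation : ∀ {n} (F : LinSystem n) → width (negation F) ≡ length F
width-negation = length-map complement

width-negation≤ : ∀ {n k} (F : LinSystem n) → length F ≤ k → width (negation F) ≤ k
width-negation≤ F |F|≤k = subst (_≤ _) (sym (width-negation F)) |F|≤k

module _ {n} (x : Assignment n) where

  satLit? : Decidable (SatLit x)
  satLit? (f == α) = eval f x Bool.≟ α

  solves? : Decidable (Solves x)
  solves? = all? satLit?

  satClause? : Decidable (SatClause x)
  satClause? = any? satLit?

module _ {n} {x : Assignment n} where

  satClause-negation⁺ : ∀ {F} → ¬ Solves x F → SatClause x (negation F)
  satClause-negation⁺ {F} ¬sol = Any-map⁺ (Any.map ¬-not (¬All⇒Any¬ (satLit? x) F ¬sol))

  satClause-negation⁻ : ∀ {F} → SatClause x (negation F) → ¬ Solves x F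
  satClause-negation⁻ sat = Any¬⇒¬All (Any.map (flip not-¬) (Any-map⁻ sat))

assignments : ∀ n → List (Assignment n)
assignments = vectors bools

∈-assignments : ∀ n → Enumerates (assignments n)
∈-assignments = ∈-vectors ∈-bools

linEqs : ∀ n → List (LinEq n)
linEqs n = cartesianProductWith _==_ (vectors bools n) bools

∈-linEqs : ∀ n → Enumerates (linEqs n)
∈-linEqs n (f == α) =
  ∈-cartesianProductWith⁺ _==_ (∈-vectors ∈-bools n f) (∈-bools α)

_⊨?_ : ∀ {n} (F G : LinSystem n) → Dec (F ⊨ G)
F ⊨? G = ∀?-over (∈-assignments _) (λ x → solves? x F →-dec solves? x G)

module WidthGame {n} (φ : CNF n) (k : ℕ) where

  ContradictsAxiom : Pred (LinSystem n) _
  ContradictsAxiom F = Any (λ C → ¬ ∃ λ x → Solves x F × SatClause x C) φ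

  Splits : ∀ {ℓ} → Pred (LinSystem n) ℓ → Pred (LinSystem n) ℓ
  Splits L F = suc (length F) ≤ k × ∃ λ f → L ((f == false) ∷ F) × L ((f == true) ∷ F)

  Weakens : ∀ {ℓ} → Pred (LinSystem n) ℓ → Pred (LinSystem n) ℓ
  Weakens L F = ∃ λ G → length G ≤ k × F ⊨ G × L G

  Refutable : ℕ → Pred (LinSystem n) _
  Refutable zero    F = ContradictsAxiom F
  Refutable (suc m) F = Refutable m F ⊎ Splits (Refutable m) F ⊎ Weakens (Refutable m) F

  contradictsAxiom? : Decidable ContradictsAxiom
  contradictsAxiom? F =
    any? (λ C → ¬? (∃?-over (∈-assignments n) (λ x → solves? x F ×-dec satClause? x C))) φ

  refutable? : ∀ m → Decidable (Refutable m)
  refutable? zero    F = contradictsAxiom? F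
  refutable? (suc m) F = refutable? m F ⊎-dec (splits? ⊎-dec weakens?)
    where
    splits? : Dec (Splits (Refutable m) F)
    splits? = suc (length F) ≤? k ×-dec
              ∃?-over (∈-vectors ∈-bools n) (λ f → refutable? m _ ×-dec refutable? m _)

    weakens? : Dec (Weakens (Refutable m) F)
    weakens? = ∃?-within (lists≤ (linEqs n) k) (λ (|G|≤k , _) → ∈-lists≤ (∈-linEqs n) |G|≤k)
                         (λ G → length G ≤? k ×-dec (F ⊨? G ×-dec refutable? m G))

  contradictsAxiom⇒refutable : ∀ m {F} → ContradictsAxiom F → Refutable m F
  contradictsAxiom⇒refutable zero    ref = ref
  contradictsAxiom⇒refutable (suc m) ref = inj₁ (contradictsAxiom⇒refutable m ref)

  refutable⇒derivable : All (λ C → width C ≤ k) φ →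
                        ∀ m {F} → length F ≤ k → Refutable m F → Deriv φ k (negation F)
  refutable⇒derivable narrow zero {F} |F|≤k contra =
    let C , C∈φ , none = find contra in
    weaken (axiom C∈φ (All.lookup narrow C∈φ))
           (λ x sat → satClause-negation⁺ (λ sol → none (x , sol , sat)))
           (width-negation≤ F |F|≤k)
  refutable⇒derivable narrow (suc m) |F|≤k (inj₁ ref) = refutable⇒derivable narrow m |F|≤k ref
  refutable⇒derivable narrow (suc m) {F} |F|≤k (inj₂ (inj₁ (|F|<k , f , ref₀ , ref₁))) =
    -- ¬(F ∧ f = 1) is (f = 0) ∨ ¬F and ¬(F ∧ f = 0) is (f = 1) ∨ ¬F.
    resolve f (negation F) (negation F)
            (refutable⇒derivable narrow m |F|<k ref₁) (refutable⇒derivable narrow m |F|<k ref₀)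
            (λ _ → ⇔-refl) (λ _ → ⇔-refl) (λ _ → ⇔-sym (++-idempotent (negation F)))
            (width-negation≤ F |F|≤k)
  refutable⇒derivable narrow (suc m) {F} |F|≤k (inj₂ (inj₂ (G , |G|≤k , F⊨G , ref))) =
    weaken (refutable⇒derivable narrow m |G|≤k ref)
           (λ x sat → satClause-negation⁺ (satClause-negation⁻ sat ∘ F⊨G x))
           (width-negation≤ F |F|≤k)

  private
    stabilisation : ∃ λ M → All (λ F → Refutable (suc M) F → Refutable M F) (lists≤ (linEqs n) k)
    stabilisation = increasing-chain-stabilises refutable? (λ _ → inj₁) (lists≤ (linEqs n) k)

    M : ℕ
    M = proj₁ stabilisation

    refutable-closed : ∀ {F} → length F ≤ k → Refutable (suc M) F → Refutable M F
    refutable-closed |F|≤k = All.lookup (proj₂ stabilisation) (∈-lists≤ (∈-linEqs n) |F|≤k)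

  Surviving : Pred (LinSystem n) _
  Surviving F = length F ≤ k × ¬ Refutable M F

  surviving-isWinningStrategy : All (λ C → width C ≤ k) φ → ¬ HasRefutationOfWidth φ k →
                                IsWinningStrategy φ k Surviving
  surviving-isWinningStrategy narrow irrefutable = record
    { nonEmpty = [] , z≤n , irrefutable ∘ refutable⇒derivable narrow M z≤n
    ; size     = λ _ → proj₁
    ; satCl    = satCl
    ; closed   = closed
    ; extend   = extend
    }
    where
    satCl : ∀ F → Surviving F → ∀ C → C ∈ φ → ∃ λ x → Solves x F × SatClause x C
    satCl F (_ , alive) C C∈φ
      with ∃?-over (∈-assignments n) (λ x → solves? x F ×-dec satClause? x C)
    ... | yes sat  = sat
    ... | no unsat = contradiction (contradictsAxiom⇒refutable M (lose C∈φ unsat)) alive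

    closed : ∀ F G → Surviving F → length G ≤ k → F ⊨ G → Surviving G
    closed F G (|F|≤k , alive) |G|≤k F⊨G =
      |G|≤k , λ ref → alive (refutable-closed |F|≤k (inj₂ (inj₂ (G , |G|≤k , F⊨G , ref))))

    extend : ∀ F → Surviving F → suc (length F) ≤ k → ∀ f → ∃ λ a → Surviving ((f == a) ∷ F)
    extend F (|F|≤k , alive) |F|<k f
      with refutable? M ((f == false) ∷ F) | refutable? M ((f == true) ∷ F)
    ... | no alive₀ | _         = false , |F|<k , alive₀
    ... | yes _     | no alive₁ = true , |F|<k , alive₁
    ... | yes ref₀  | yes ref₁  =
      contradiction (refutable-closed |F|≤k (inj₂ (inj₁ (|F|<k , f , ref₀ , ref₁)))) alive

lemma4p1 : (n r k : ℕ) (φ : CNF n) → IsLinearCNF r φ → r ≤ k →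
           ¬ HasRefutationOfWidth φ k →
           ∃ λ (H : LinSystem n → Set) → IsWinningStrategy φ k H
lemma4p1 n r k φ lin r≤k irrefutable =
  Surviving , surviving-isWinningStrategy narrow irrefutable
  where
  open WidthGame φ k
  narrow : All (λ C → width C ≤ k) φ
  narrow = All.map (λ |C|≤r → ≤-trans |C|≤r r≤k) lin
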